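{- Let $D$ and $D'$ be effective divisors on a banana tree $G$. Then $D\sim D'$ if and only if $D$ can be transformed into $D'$ by a finite sequence of legal adjacency moves.
   Context: Graphs are finite, connected, loopless multigraphs. A banana tree is a multigraph whose underlying simple graph (one edge kept between each adjacent pair) is a tree. For vertices $v,w$, $|E(v,w)|$ is the number of edges joining them and $\mathrm{val}(v)$ the number of edges at $v$. A divisor is a function $D:V\to\mathbb{Z}$; it is effective if nonnegative. Firing $v$ changes $D$ to $D'$ with $D'(v)=D(v)-\mathrm{val}(v)$ and $D'(w)=D(w)+|E(v,w)|$ for $w\neq v$; $D\sim D'$ (linear equivalence) if one is obtained from the other by finitely many firings. For $S\subseteq V$, the subset-firing move at $S$ fires every vertex of $S$ (net effect: one chip moves along each edge from $S$ to its complement). For adjacent vertices $v,w$ of a banana tree, the adjacency move from $v$ to $w$ is the subset-firing move at $C_v$, where $C_v$ is the vertex set of the connected component containing $v$ of the graph obtained by deleting all edges between $v$ and $w$; it moves $|E(v,w)|$ chips from $v$ to $w$. A subset-firing (in particular, adjacency) move is legal if both the divisor before and the divisor after the move are effective. -}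

module Defs where

open import Data.Nat as ℕ using (ℕ)
open import Data.Integer as ℤ using (ℤ; +_; _+_; _-_; _≤_; 0ℤ)
open import Data.Fin using (Fin; _≟_)
open import Data.List using (List; []; _∷_; map; foldr; length; allFin)
open import Data.Nat.ListAction using (sum)
open import Data.List.Relation.Unary.Unique.Propositional using (Unique)
open import Data.Bool using (Bool; true; false; if_then_else_)
open import Data.Product using (Σ; ∃; _×_; _,_)
open import Data.Sum using (_⊎_)
open import Relation.Nullary using (¬_; does)
open import Relation.Binary.PropositionalEquality using (_≡_)
open import Function.Bundles using (_⇔_)

record Multigraph : Set where
  field
    n        : ℕ
    E        : Fin n → Fin n → ℕ
    E-sym    : ∀ v w → E v w ≡ E w v
    loopless : ∀ v → E v v ≡ 0
open Multigraph public

Adjacent : {n : ℕ} → (Fin n → Fin n → ℕ) → Fin n → Fin n → Set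
Adjacent E v w = 0 ℕ.< E v w

data Walk {n : ℕ} (E : Fin n → Fin n → ℕ) : Fin n → Fin n → Set where
  here : ∀ {v} → Walk E v v
  step : ∀ {u v w} → Adjacent E u v → Walk E v w → Walk E u w

Connected : Multigraph → Set
Connected G = ∀ v w → Walk (E G) v w

ChainTo : {n : ℕ} → (Fin n → Fin n → ℕ) → List (Fin n) → Fin n → Set
ChainTo E []       z = Data.Unit.⊤ where import Data.Unit
ChainTo E (x ∷ []) z = Adjacent E x z
ChainTo E (x ∷ y ∷ xs) z = Adjacent E x y × ChainTo E (y ∷ xs) z

-- a cycle in the underlying simple graph: distinct vertices v0,…,vk (k ≥ 2),
-- consecutive ones adjacent and vk adjacent to v0
IsCycle : {n : ℕ} → (Fin n → Fin n → ℕ) → List (Fin n) → Set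
IsCycle E []       = Data.Empty.⊥ where import Data.Empty
IsCycle E (v ∷ vs) = 2 ℕ.≤ length vs × Unique (v ∷ vs) × ChainTo E (v ∷ vs) v

Acyclic : Multigraph → Set
Acyclic G = ∀ cyc → ¬ IsCycle (E G) cyc

-- banana tree: underlying simple graph (same adjacency) is a tree
-- (connected and acyclic)
BananaTree : Multigraph → Set
BananaTree G = Connected G × Acyclic G

Divisor : Multigraph → Set
Divisor G = Fin (n G) → ℤ

Effective : (G : Multigraph) → Divisor G → Set
Effective G D = ∀ v → 0ℤ ≤ D v

val : (G : Multigraph) → Fin (n G) → ℕ
val G v = sum (map (E G v) (allFin (n G)))

fireDelta : (G : Multigraph) → Fin (n G) → Fin (n G) → ℤ
fireDelta G v w = if does (w ≟ v) then ℤ.- (+ val G v) else + E G v w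

Fires : (G : Multigraph) → Divisor G → Divisor G → Set
Fires G D D' = Σ (Fin (n G)) λ v → ∀ w → D' w ≡ D w + fireDelta G v w

data Steps {A : Set} {B : Set} (R : (A → B) → (A → B) → Set) :
           (A → B) → (A → B) → Set where
  done : ∀ {D D'} → (∀ a → D a ≡ D' a) → Steps R D D'
  more : ∀ {D D' D''} → R D D' → Steps R D' D'' → Steps R D D''

LinEquiv : (G : Multigraph) → Divisor G → Divisor G → Set
LinEquiv G D D' = Steps (Fires G) D D' ⊎ Steps (Fires G) D' D

subsetFire : (G : Multigraph) → (Fin (n G) → Bool) → Divisor G → Divisor G
subsetFire G S D w =
  D w + foldr _+_ 0ℤ (map (λ v → if S v then fireDelta G v w else 0ℤ) (allFin (n G)))

deleteEdges : (G : Multigraph) → Fin (n G) → Fin (n G) → Fin (n G) → Fin (n G) → ℕ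
deleteEdges G v w x y =
  if (does (x ≟ v) Data.Bool.∧ does (y ≟ w)) Data.Bool.∨
     (does (x ≟ w) Data.Bool.∧ does (y ≟ v))
  then 0 else E G x y
  where import Data.Bool

IsComponentSet : (G : Multigraph) → Fin (n G) → Fin (n G) → (Fin (n G) → Bool) → Set
IsComponentSet G v w S = ∀ u → (S u ≡ true) ⇔ Walk (deleteEdges G v w) v u

AdjacencyMove : (G : Multigraph) → Divisor G → Divisor G → Set
AdjacencyMove G D D' =
  Σ (Fin (n G)) λ v → Σ (Fin (n G)) λ w → Σ (Fin (n G) → Bool) λ S →
    Adjacent (E G) v w × IsComponentSet G v w S ×
    (∀ u → D' u ≡ subsetFire G S D u)

LegalAdjacencyMove : (G : Multigraph) → Divisor G → Divisor G → Set
LegalAdjacencyMove G D D' = Effective G D × Effective G D' × AdjacencyMove G D D'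

{-# OPTIONS --safe #-}
module Submission where

-- Firing every vertex x exactly f x times turns D into D + Δf, so D ~ D' iff D' = D + Δf for an
-- integer potential f, and a legal adjacency move, being a subset firing, is a sequence of firings.
-- Conversely let D' = D + Δf with D, D' effective. If f is not constant, pick a vertex c where f is
-- maximal with a neighbour d where f is smaller, and let S = C_c. In a banana tree the c–d edges are
-- the only edges leaving S, so firing S takes chips only from c, and there it takes E(c,d) ≤ -Δf(c)
-- of them: the new divisor D₁ satisfies D₁(c) ≥ D'(c) ≥ 0 and is effective. Moreover
-- D' = D₁ + Δ(f - 1_S), and lowering f on S shrinks the variation Σ E(u,x)|f(u) - f(x)|, since only
-- the c–d edges change and their gap drops by one. Induction on the variation ends with f constant,
-- where D = D'.

open import Defs
open import Function.Base using (_∘_; id)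
open import Function.Bundles using (_⇔_; mk⇔; Equivalence)
open import Function.Definitions using (Injective)
open import Data.Bool using (Bool; true; false; if_then_else_; _∨_)
open import Data.Bool.Properties using (¬-not)
open import Data.Fin using (Fin; zero; suc; _≟_)
open import Data.Fin.Properties using (any?; injective⇒≤)
open import Data.Integer as ℤ using (ℤ; +_; _+_; _-_; _*_; -_; 0ℤ; 1ℤ; -1ℤ; ∣_∣)
import Data.Integer.Properties as ℤP
open import Data.Integer.Tactic.RingSolver using (solve-∀)
open import Data.List using (List; []; _∷_; map; foldr; length; lookup; tabulate; allFin)
open import Data.List.Properties using (map-tabulate)
import Data.List.Relation.Unary.All as All
open import Data.List.Relation.Unary.All.Properties using (¬Any⇒All¬)
open import Data.List.Relation.Unary.Any using (here; there)
open import Data.List.Relation.Unary.AllPairs using ([]; _∷_)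
open import Data.List.Relation.Unary.Unique.Propositional using (Unique)
open import Data.List.Membership.Propositional using (_∈_; lose)
open import Data.List.Membership.Propositional.Properties using (∈-lookup; ∈-allFin)
import Data.List.Membership.DecPropositional as DecMembership
import Data.List.Extrema ℤP.≤-totalOrder as ℤExtrema
open import Data.Nat as ℕ using (ℕ; zero; suc; z≤n; s≤s; z<s)
import Data.Nat.Properties as ℕP
open import Data.Nat.Induction using (<-wellFounded)
open import Data.Nat.ListAction using (sum)
open import Data.Product using (Σ; ∃₂; _×_; _,_; proj₁; proj₂)
open import Data.Sum using (_⊎_; inj₁; inj₂)
open import Data.Vec.Functional.Relation.Binary.Pointwise.Properties using (foldr-cong)
open import Induction.WellFounded using (Acc; acc)
open import Relation.Binary.PropositionalEquality
open import Relation.Nullary using (¬_; Dec; yes; no; does; _×-dec_; contradiction)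
open import Relation.Nullary.Decidable using (dec-true; dec-false; map′)
open import Relation.Unary using (Pred; Decidable)

open import Algebra.Properties.Semiring.Sum ℤP.+-*-semiring
  using (sum-syntax; ∑-distrib-+; *-distribˡ-sum; sum-cong-≗; sum-replicate-zero)
import Algebra.Properties.Semiring.Sum ℕP.+-*-semiring as ℕ∑

∑-neg : ∀ {k} (g : Fin k → ℤ) → ∑[ x < k ] (- g x) ≡ - ∑[ x < k ] g x
∑-neg {zero}  g = refl
∑-neg {suc k} g =
  trans (cong (λ r → - g zero + r) (∑-neg (g ∘ suc))) (sym (ℤP.neg-distrib-+ (g zero) _))

∑-distrib-- : ∀ {k} (g h : Fin k → ℤ) →
              ∑[ x < k ] (g x - h x) ≡ ∑[ x < k ] g x - ∑[ x < k ] h x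
∑-distrib-- g h = trans (∑-distrib-+ g (λ x → - h x)) (cong (λ r → ∑[ x < _ ] g x + r) (∑-neg h))

∑-δ : ∀ {k} (i : Fin k) (g : Fin k → ℤ) → ∑[ x < k ] (if does (i ≟ x) then g x else 0ℤ) ≡ g i
∑-δ {suc k} zero    g = trans (cong (λ r → g zero + r) (sum-replicate-zero k)) (ℤP.+-identityʳ (g zero))
∑-δ {suc k} (suc i) g = trans (ℤP.+-identityˡ _) (∑-δ i (g ∘ suc))

∑-mono-≤ : ∀ {k} {g h : Fin k → ℤ} → (∀ x → g x ℤ.≤ h x) → ∑[ x < k ] g x ℤ.≤ ∑[ x < k ] h x
∑-mono-≤ = foldr-cong {R = ℤ._≤_} {S = ℤ._≤_} {f = _+_} {g = _+_} ℤP.+-mono-≤ ℤP.≤-refl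

∑ℕ-mono-≤ : ∀ {k} {g h : Fin k → ℕ} → (∀ x → g x ℕ.≤ h x) → ℕ∑.sum g ℕ.≤ ℕ∑.sum h
∑ℕ-mono-≤ = foldr-cong {R = ℕ._≤_} {S = ℕ._≤_} {f = ℕ._+_} {g = ℕ._+_} ℕP.+-mono-≤ ℕP.≤-refl

∑ℕ-mono-< : ∀ {k} {g h : Fin k → ℕ} → (∀ x → g x ℕ.≤ h x) →
            ∀ j → g j ℕ.< h j → ℕ∑.sum g ℕ.< ℕ∑.sum h
∑ℕ-mono-< g≤h zero    gⱼ<hⱼ = ℕP.+-mono-<-≤ gⱼ<hⱼ (∑ℕ-mono-≤ (g≤h ∘ suc))
∑ℕ-mono-< g≤h (suc j) gⱼ<hⱼ = ℕP.+-mono-≤-< (g≤h zero) (∑ℕ-mono-< (g≤h ∘ suc) j gⱼ<hⱼ)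

foldr-tabulate : ∀ {k} (g : Fin k → ℤ) → foldr _+_ 0ℤ (tabulate g) ≡ ∑[ x < k ] g x
foldr-tabulate {zero}  g = refl
foldr-tabulate {suc k} g = cong (λ r → g zero + r) (foldr-tabulate (g ∘ suc))

foldr-allFin : ∀ {k} (g : Fin k → ℤ) → foldr _+_ 0ℤ (map g (allFin k)) ≡ ∑[ x < k ] g x
foldr-allFin g = trans (cong (foldr _+_ 0ℤ) (map-tabulate id g)) (foldr-tabulate g)

+sum-tabulate : ∀ {k} (g : Fin k → ℕ) → + sum (tabulate g) ≡ ∑[ x < k ] (+ g x)
+sum-tabulate {zero}  g = refl
+sum-tabulate {suc k} g =
  trans (ℤP.pos-+ (g zero) _) (cong (λ r → + g zero + r) (+sum-tabulate (g ∘ suc)))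

*-monoʳ-≤-ifPos : ∀ e {a b} → (0 ℕ.< e → a ℕ.≤ b) → e ℕ.* a ℕ.≤ e ℕ.* b
*-monoʳ-≤-ifPos zero    _   = z≤n
*-monoʳ-≤-ifPos (suc e) a≤b = ℕP.*-monoʳ-≤ (suc e) (a≤b z<s)

+*-monoʳ-≤-ifPos : ∀ e {a b} → (0 ℕ.< e → a ℤ.≤ b) → + e * a ℤ.≤ + e * b
+*-monoʳ-≤-ifPos zero    _   = ℤP.≤-refl
+*-monoʳ-≤-ifPos (suc e) a≤b = ℤP.*-monoˡ-≤-nonNeg (+ suc e) (a≤b z<s)

i<j⇒0<j-i : ∀ {i j} → i ℤ.< j → 0ℤ ℤ.< j - i
i<j⇒0<j-i {i} {j} i<j = subst (ℤ._< j - i) (ℤP.+-inverseʳ i) (ℤP.+-monoˡ-< (- i) i<j)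

i<j⇒i-j≤-1 : ∀ {i j} → i ℤ.< j → i - j ℤ.≤ -1ℤ
i<j⇒i-j≤-1 {i} {j} i<j =
  ℤP.i<j⇒i≤pred[j] (subst (i - j ℤ.<_) (ℤP.+-inverseʳ j) (ℤP.+-monoˡ-< (- j) i<j))

[i-k]-[j-k]≡i-j : ∀ i j k → (i - k) - (j - k) ≡ i - j
[i-k]-[j-k]≡i-j = solve-∀

∣i-1∣<∣i∣ : ∀ {i} → 0ℤ ℤ.< i → ∣ i - 1ℤ ∣ ℕ.< ∣ i ∣
∣i-1∣<∣i∣ (ℤ.+<+ {n = suc k} _) = ℕP.n<1+n k

does-true⇒ : ∀ {A : Set} (a? : Dec A) → does a? ≡ true → A
does-true⇒ (yes a) _  = a
does-true⇒ (no _)  ()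

argmax : ∀ {k} (f : Fin k → ℤ) → Fin k → Σ (Fin k) λ m → ∀ x → f x ℤ.≤ f m
argmax {k} f a =
  ℤExtrema.argmax f a (allFin k) ,
  λ x → ℤExtrema.v≤f[argmax]⁺ a (allFin k) (inj₂ (lose (∈-allFin x) ℤP.≤-refl))

Unique⇒lookup-injective : ∀ {A : Set} {xs : List A} → Unique xs → Injective _≡_ _≡_ (lookup xs)
Unique⇒lookup-injective (_ ∷ _)      {zero}  {zero}  _     = refl
Unique⇒lookup-injective (x∉xs ∷ _)   {zero}  {suc j} x≡xⱼ  =
  contradiction x≡xⱼ (All.lookup x∉xs (∈-lookup j))
Unique⇒lookup-injective (x∉xs ∷ _)   {suc i} {zero}  xᵢ≡x  =
  contradiction (sym xᵢ≡x) (All.lookup x∉xs (∈-lookup i))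
Unique⇒lookup-injective (_ ∷ unique) {suc i} {suc j} xᵢ≡xⱼ =
  cong suc (Unique⇒lookup-injective unique xᵢ≡xⱼ)

Unique-length≤ : ∀ {N} {xs : List (Fin N)} → Unique xs → length xs ℕ.≤ N
Unique-length≤ unique = injective⇒≤ (Unique⇒lookup-injective unique)

Steps-≗ʳ : ∀ {A B : Set} {R : (A → B) → (A → B) → Set} {D D' D''} →
           Steps R D D' → D' ≗ D'' → Steps R D D''
Steps-≗ʳ (done D≗D')   D'≗D'' = done (λ a → trans (D≗D' a) (D'≗D'' a))
Steps-≗ʳ (more r rest) D'≗D'' = more r (Steps-≗ʳ rest D'≗D'')

Steps-trans : ∀ {A B : Set} {R : (A → B) → (A → B) → Set} →
              (∀ {D₁ D₂ D₃} → D₁ ≗ D₂ → R D₂ D₃ → R D₁ D₃) →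
              ∀ {D D' D''} → Steps R D D' → Steps R D' D'' → Steps R D D''
Steps-trans resp (done D≗D')   (done D'≗D'') = done (λ a → trans (D≗D' a) (D'≗D'' a))
Steps-trans resp (done D≗D')   (more r rest) = more (resp D≗D' r) rest
Steps-trans resp (more r rest) rest'         = more r (Steps-trans resp rest rest')

module _ {N : ℕ} {E : Fin N → Fin N → ℕ} where
  open DecMembership (_≟_ {n = N}) using (_∈?_)

  vertices : ∀ {s t} → Walk E s t → List (Fin N)
  vertices {s} here       = s ∷ []
  vertices {s} (step _ p) = s ∷ vertices p

  vertices-nonempty : ∀ {s t} (p : Walk E s t) → 1 ℕ.≤ length (vertices p)
  vertices-nonempty here       = s≤s z≤n
  vertices-nonempty (step _ _) = s≤s z≤n

  vertices-chain : ∀ {E′ : Fin N → Fin N → ℕ} → (∀ {u x} → Adjacent E u x → Adjacent E′ u x) →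
                   ∀ {s t z} (p : Walk E s t) → Adjacent E′ t z → ChainTo E′ (vertices p) z
  vertices-chain E⊆E′ here                    t~z = t~z
  vertices-chain E⊆E′ (step s~v here)         t~z = E⊆E′ s~v , t~z
  vertices-chain E⊆E′ (step s~v p@(step _ _)) t~z = E⊆E′ s~v , vertices-chain E⊆E′ p t~z

  _▷_ : ∀ {s u x} → Walk E s u → Adjacent E u x → Walk E s x
  here       ▷ u~x = step u~x here
  step s~v p ▷ u~x = step s~v (p ▷ u~x)

  SimpleWalk : Fin N → Fin N → Set
  SimpleWalk s t = Σ (Walk E s t) λ p → Unique (vertices p)

  suffix : ∀ {s t v} (p : Walk E s t) → Unique (vertices p) → v ∈ vertices p → SimpleWalk v t
  suffix here         unique       (here refl) = here , unique
  suffix (step s~v p) unique       (here refl) = step s~v p , unique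
  suffix (step _ p)   (_ ∷ unique) (there v∈p) = suffix p unique v∈p

  simplify : ∀ {s t} → Walk E s t → SimpleWalk s t
  simplify here = here , (All.[] ∷ [])
  simplify {s} (step s~v p) with simplify p
  ... | q , q-unique with s ∈? vertices q
  ...   | yes s∈q = suffix q q-unique s∈q
  ...   | no  s∉q = step s~v q , (¬Any⇒All¬ (vertices q) s∉q ∷ q-unique)

  walkWithin? : ∀ k s t → Dec (Σ (Walk E s t) λ p → length (vertices p) ℕ.≤ k)
  walkWithin? zero    s t = no λ { (here , ()) ; (step _ _ , ()) }
  walkWithin? (suc k) s t with s ≟ t
  ... | yes refl = yes (here , s≤s z≤n)
  ... | no  s≢t  =
    map′ (λ (_ , s~x , p , ≤k) → step s~x p , s≤s ≤k)
         (λ { (here , _) → contradiction refl s≢t ; (step s~x p , s≤s ≤k) → _ , s~x , p , ≤k })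
         (any? λ x → (0 ℕ.<? E s x) ×-dec walkWithin? k x t)

  walk? : ∀ s t → Dec (Walk E s t)
  walk? s t = map′ proj₁ shorten (walkWithin? N s t)
    where
    shorten : Walk E s t → Σ (Walk E s t) λ p → length (vertices p) ℕ.≤ N
    shorten p = let (q , q-unique) = simplify p in q , Unique-length≤ q-unique

  walk-exits : ∀ {p} {P : Pred (Fin N) p} → Decidable P → ∀ {s t} → Walk E s t → P s → ¬ P t →
               ∃₂ λ c d → Adjacent E c d × P c × ¬ P d
  walk-exits P? here                 Ps ¬Pt = contradiction Ps ¬Pt
  walk-exits P? (step {v = v} s~v p) Ps ¬Pt with P? v
  ... | yes Pv  = walk-exits P? p Pv ¬Pt
  ... | no  ¬Pv = _ , v , s~v , Ps , ¬Pv

module _ (G : Multigraph) where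
  private
    V : Set
    V = Fin (n G)

  -- Δ is minus the graph Laplacian, so that firing f x times at each x turns D into D +Δ f.
  Δ : (V → ℤ) → V → ℤ
  Δ f u = ∑[ x < n G ] (+ E G u x * (f x - f u))

  infixl 6 _+Δ_
  _+Δ_ : Divisor G → (V → ℤ) → Divisor G
  (D +Δ f) u = D u + Δ f u

  Δ-cong : ∀ {f g} → f ≗ g → Δ f ≗ Δ g
  Δ-cong f≗g u = sum-cong-≗ λ x → cong₂ (λ a b → + E G u x * (a - b)) (f≗g x) (f≗g u)

  Δ-+ : ∀ f g u → Δ (λ x → f x + g x) u ≡ Δ f u + Δ g u
  Δ-+ f g u =
    trans (sum-cong-≗ λ x → distrib (+ E G u x) (f x) (g x) (f u) (g u)) (∑-distrib-+ {n G} _ _)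
    where
    distrib : ∀ e a b c d → e * ((a + b) - (c + d)) ≡ e * (a - c) + e * (b - d)
    distrib = solve-∀

  Δ-flat : ∀ f u → (∀ x → f x ≡ f u) → Δ f u ≡ 0ℤ
  Δ-flat f u flat = trans (sum-cong-≗ vanish) (sum-replicate-zero (n G))
    where
    open ≡-Reasoning
    vanish : ∀ x → + E G u x * (f x - f u) ≡ 0ℤ
    vanish x = begin
      + E G u x * (f x - f u) ≡⟨ cong (λ a → + E G u x * (a - f u)) (flat x) ⟩
      + E G u x * (f u - f u) ≡⟨ cong (+ E G u x *_) (ℤP.+-inverseʳ (f u)) ⟩
      + E G u x * 0ℤ          ≡⟨ ℤP.*-zeroʳ (+ E G u x) ⟩
      0ℤ                      ∎

  Δ-mono : ∀ f g u → (∀ x → Adjacent (E G) u x → f x - f u ℤ.≤ g x - g u) → Δ f u ℤ.≤ Δ g u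
  Δ-mono f g u slope≤ = ∑-mono-≤ λ x → +*-monoʳ-≤-ifPos (E G u x) (slope≤ x)

  +Δ-flat : ∀ {D f} → (∀ u x → f x ≡ f u) → D +Δ f ≗ D
  +Δ-flat {D} {f} flat u = trans (cong (λ r → D u + r) (Δ-flat f u (flat u))) (ℤP.+-identityʳ (D u))

  +Δ-cong : ∀ {D D' f g} → D' ≗ D +Δ f → f ≗ g → D' ≗ D +Δ g
  +Δ-cong {D} D'≡ f≗g u = trans (D'≡ u) (cong (λ r → D u + r) (Δ-cong f≗g u))

  +Δ-trans : ∀ {D D₁ D₂ f g} → D₁ ≗ D +Δ f → D₂ ≗ D₁ +Δ g → D₂ ≗ D +Δ (λ x → f x + g x)
  +Δ-trans {D} {D₁} {D₂} {f} {g} D₁≡ D₂≡ u = begin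
    D₂ u                        ≡⟨ D₂≡ u ⟩
    D₁ u + Δ g u                ≡⟨ cong (_+ Δ g u) (D₁≡ u) ⟩
    D u + Δ f u + Δ g u         ≡⟨ ℤP.+-assoc (D u) _ _ ⟩
    D u + (Δ f u + Δ g u)       ≡⟨ cong (λ r → D u + r) (Δ-+ f g u) ⟨
    D u + Δ (λ x → f x + g x) u ∎
    where open ≡-Reasoning

  +Δ-sym : ∀ {D D' g} → D' ≗ D +Δ g → D ≗ D' +Δ (λ x → - g x)
  +Δ-sym {D} {D'} {g} D'≡ u = sym (begin
    D' u + Δ -g u               ≡⟨ cong (_+ Δ -g u) (D'≡ u) ⟩
    D u + Δ g u + Δ -g u        ≡⟨ ℤP.+-assoc (D u) _ _ ⟩
    D u + (Δ g u + Δ -g u)      ≡⟨ cong (λ r → D u + r) (Δ-+ g -g u) ⟨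
    D u + Δ (λ x → g x - g x) u ≡⟨ cong (λ r → D u + r) (Δ-flat _ u cancel) ⟩
    D u + 0ℤ                    ≡⟨ ℤP.+-identityʳ (D u) ⟩
    D u                         ∎)
    where
    open ≡-Reasoning
    -g : V → ℤ
    -g x = - g x
    cancel : ∀ x → g x - g x ≡ g u - g u
    cancel x = trans (ℤP.+-inverseʳ (g x)) (sym (ℤP.+-inverseʳ (g u)))

  indicator : (V → Bool) → V → ℤ
  indicator S x = if S x then 1ℤ else 0ℤ

  δ : V → V → ℤ
  δ v = indicator (λ x → does (v ≟ x))

  +val : ∀ u → + val G u ≡ ∑[ x < n G ] (+ E G u x)
  +val u = trans (cong (λ xs → + sum xs) (map-tabulate id (E G u))) (+sum-tabulate (E G u))

  *-fireDelta : ∀ (f : V → ℤ) u x →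
                f x * fireDelta G x u ≡
                f x * + E G u x - (if does (u ≟ x) then f u * + val G u else 0ℤ)
  *-fireDelta f u x with u ≟ x
  ... | yes refl rewrite loopless G u = negate (f u) (+ val G u)
    where
    negate : ∀ a v → a * - v ≡ a * 0ℤ - a * v
    negate = solve-∀
  ... | no _ rewrite E-sym G x u = sym (ℤP.+-identityʳ _)

  ∑-*-fireDelta : ∀ (f : V → ℤ) u → ∑[ x < n G ] (f x * fireDelta G x u) ≡ Δ f u
  ∑-*-fireDelta f u = begin
    ∑[ x < n G ] (f x * fireDelta G x u)
      ≡⟨ sum-cong-≗ (*-fireDelta f u) ⟩
    ∑[ x < n G ] (f x * + E G u x - (if does (u ≟ x) then f u * + val G u else 0ℤ))
      ≡⟨ ∑-distrib-- {n G} _ _ ⟩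
    ∑fE - ∑[ x < n G ] (if does (u ≟ x) then f u * + val G u else 0ℤ)
      ≡⟨ cong (λ r → ∑fE - r) (∑-δ u (λ _ → f u * + val G u)) ⟩
    ∑fE - f u * + val G u
      ≡⟨ cong (λ v → ∑fE - f u * v) (+val u) ⟩
    ∑fE - f u * ∑[ x < n G ] (+ E G u x)
      ≡⟨ cong (λ r → ∑fE - r) (*-distribˡ-sum {n G} (f u) _) ⟩
    ∑fE - ∑[ x < n G ] (f u * + E G u x)
      ≡⟨ ∑-distrib-- {n G} _ _ ⟨
    ∑[ x < n G ] (f x * + E G u x - f u * + E G u x)
      ≡⟨ sum-cong-≗ (λ x → factor (+ E G u x) (f x) (f u)) ⟩
    Δ f u ∎
    where
    open ≡-Reasoning
    ∑fE : ℤ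
    ∑fE = ∑[ x < n G ] (f x * + E G u x)
    factor : ∀ e a b → a * e - b * e ≡ e * (a - b)
    factor = solve-∀

  ∑-subsetFire : ∀ (S : V → Bool) u →
                 ∑[ x < n G ] (if S x then fireDelta G x u else 0ℤ) ≡ Δ (indicator S) u
  ∑-subsetFire S u = trans (sum-cong-≗ select) (∑-*-fireDelta (indicator S) u)
    where
    select : ∀ x → (if S x then fireDelta G x u else 0ℤ) ≡ indicator S x * fireDelta G x u
    select x with S x
    ... | true  = sym (ℤP.*-identityˡ _)
    ... | false = refl

  subsetFire-Δ : ∀ S D → subsetFire G S D ≗ D +Δ indicator S
  subsetFire-Δ S D u = cong (λ r → D u + r) (trans (foldr-allFin {n G} _) (∑-subsetFire S u))

  fireDelta-Δ : ∀ v u → fireDelta G v u ≡ Δ (δ v) u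
  fireDelta-Δ v u =
    trans (sym (∑-δ v (λ x → fireDelta G x u))) (∑-subsetFire (λ x → does (v ≟ x)) u)

  Fires-respˡ : ∀ {D₁ D₂ D₃} → D₁ ≗ D₂ → Fires G D₂ D₃ → Fires G D₁ D₃
  Fires-respˡ D₁≗D₂ (v , D₃≡) =
    v , λ w → trans (D₃≡ w) (cong (_+ fireDelta G v w) (sym (D₁≗D₂ w)))

  firings⇒potential : ∀ {D D'} → Steps (Fires G) D D' → Σ (V → ℤ) λ f → D' ≗ D +Δ f
  firings⇒potential {D} (done D≗D') =
    (λ _ → 0ℤ) , λ u → trans (sym (D≗D' u)) (sym (+Δ-flat {D} {λ _ → 0ℤ} (λ _ _ → refl) u))
  firings⇒potential {D} {D'} (more {D' = D₁} (v , D₁≡) rest) =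
    let (g , D'≡) = firings⇒potential rest
        D₁≡D+Δδ u = trans (D₁≡ u) (cong (λ r → D u + r) (fireDelta-Δ v u))
    in  (λ x → δ v x + g x) , +Δ-trans {D} {D₁} {D'} {δ v} {g} D₁≡D+Δδ D'≡

  linEquiv⇒potential : ∀ {D D'} → LinEquiv G D D' → Σ (V → ℤ) λ f → D' ≗ D +Δ f
  linEquiv⇒potential (inj₁ firings) = firings⇒potential firings
  linEquiv⇒potential {D} {D'} (inj₂ firings) =
    let (g , D≡) = firings⇒potential firings in (λ x → - g x) , +Δ-sym {D'} {D} {g} D≡

  subsetFire-firings : ∀ S D → Steps (Fires G) D (subsetFire G S D)
  subsetFire-firings S = fireEach (allFin (n G))
    where
    fireEach : ∀ xs D → Steps (Fires G) D
                 (λ w → D w + foldr _+_ 0ℤ (map (λ v → if S v then fireDelta G v w else 0ℤ) xs))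
    fireEach []       D = done (λ w → sym (ℤP.+-identityʳ (D w)))
    fireEach (v ∷ xs) D with S v
    ... | true  = more (v , λ w → refl) (Steps-≗ʳ (fireEach xs _) (λ w → ℤP.+-assoc (D w) _ _))
    ... | false = Steps-≗ʳ (fireEach xs D) (λ w → cong (λ r → D w + r) (sym (ℤP.+-identityˡ _)))

  legalMoves⇒firings : ∀ {D D'} → Steps (LegalAdjacencyMove G) D D' → Steps (Fires G) D D'
  legalMoves⇒firings (done D≗D') = done D≗D'
  legalMoves⇒firings (more (_ , _ , _ , _ , S , _ , _ , D₁≡) rest) =
    Steps-trans Fires-respˡ (Steps-≗ʳ (subsetFire-firings S _) (λ u → sym (D₁≡ u)))
                (legalMoves⇒firings rest)

  potential-subsetFire : ∀ S {D D' f} → D' ≗ D +Δ f →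
                         D' ≗ subsetFire G S D +Δ (λ x → f x - indicator S x)
  potential-subsetFire S {D} {D'} {f} D'≡ = +Δ-cong {D₁} {D'} D'≡D₁+Δ[-𝟙+f] reorder
    where
    D₁ : Divisor G
    D₁ = subsetFire G S D
    D'≡D₁+Δ[-𝟙+f] : D' ≗ D₁ +Δ (λ x → - indicator S x + f x)
    D'≡D₁+Δ[-𝟙+f] = +Δ-trans {D₁} {D} {D'} {λ x → - indicator S x} {f}
                      (+Δ-sym {D} {D₁} {indicator S} (subsetFire-Δ S D)) D'≡
    reorder : ∀ x → - indicator S x + f x ≡ f x - indicator S x
    reorder x = ℤP.+-comm (- indicator S x) (f x)

  variation : (V → ℤ) → ℕ
  variation f = ℕ∑.sum λ u → ℕ∑.sum λ x → E G u x ℕ.* ∣ f u - f x ∣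

  Adjacent-sym : ∀ {u x} → Adjacent (E G) u x → Adjacent (E G) x u
  Adjacent-sym {u} {x} = subst (0 ℕ.<_) (E-sym G u x)

  constant⊎peakEdge : Connected G → ∀ f →
    (∀ u x → f x ≡ f u) ⊎ ∃₂ λ c d → Adjacent (E G) c d × (∀ x → f x ℤ.≤ f c) × f d ℤ.< f c
  constant⊎peakEdge connected f with any? (λ a → any? λ x → f x ℤ.<? f a)
  ... | no ¬drop = inj₁ λ u x → ℤP.≤-antisym (level u x) (level x u)
    where
    level : ∀ u x → f x ℤ.≤ f u
    level u x = ℤP.≮⇒≥ λ fu<fx → ¬drop (x , u , fu<fx)
  ... | yes (a , x , fx<fa) with argmax f a
  ...   | m , f≤fm with walk-exits (λ y → f m ℤ.≤? f y) (connected m x) ℤP.≤-refl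
                         (λ fm≤fx → ℤP.<-irrefl refl (ℤP.<-≤-trans fx<fa (ℤP.≤-trans (f≤fm a) fm≤fx)))
  ...     | c , d , c~d , fm≤fc , fm≰fd =
    inj₂ (c , d , c~d , (λ y → ℤP.≤-trans (f≤fm y) fm≤fc) , ℤP.<-≤-trans (ℤP.≰⇒> fm≰fd) fm≤fc)

  deleteEdges-⊆ : ∀ c d {u x} → Adjacent (deleteEdges G c d) u x → Adjacent (E G) u x
  deleteEdges-⊆ c d u~x = ℕP.<-≤-trans u~x (if-0-≤ _)
    where
    if-0-≤ : ∀ b {m} → (if b then 0 else m) ℕ.≤ m
    if-0-≤ true  = z≤n
    if-0-≤ false = ℕP.≤-refl

  deleteEdges-cd : ∀ c d → deleteEdges G c d c d ≡ 0
  deleteEdges-cd c d =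
    cong (λ b → if b ∨ does (c ≟ d ×-dec d ≟ c) then 0 else E G c d)
         (dec-true (c ≟ c ×-dec d ≟ d) (refl , refl))

  deleteEdges-keeps : ∀ c d {u x} → ¬ (u ≡ c × x ≡ d) → ¬ (u ≡ d × x ≡ c) →
                      deleteEdges G c d u x ≡ E G u x
  deleteEdges-keeps c d {u} {x} ¬cd ¬dc =
    cong₂ (λ b b′ → if b ∨ b′ then 0 else E G u x)
          (dec-false (u ≟ c ×-dec x ≟ d) ¬cd) (dec-false (u ≟ d ×-dec x ≟ c) ¬dc)

  componentSet : ∀ c d → Σ (V → Bool) (IsComponentSet G c d)
  componentSet c d =
    (λ u → does (reach? u)) , λ u → mk⇔ (does-true⇒ (reach? u)) (dec-true (reach? u))
    where
    reach? : ∀ u → Dec (Walk (deleteEdges G c d) c u)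
    reach? = walk? c

  module _ (acyclic : Acyclic G) {c d : V} (c~d : Adjacent (E G) c d) where

    bridge : ¬ Walk (deleteEdges G c d) c d
    bridge p with simplify p
    ... | here , _             = ℕP.<-irrefl (sym (loopless G c)) c~d
    ... | step c~′d here , _   = ℕP.<-irrefl (sym (deleteEdges-cd c d)) c~′d
    ... | q@(step _ (step _ r)) , q-unique =
      acyclic (vertices q)
        (s≤s (vertices-nonempty r) , q-unique , vertices-chain (deleteEdges-⊆ c d) q (Adjacent-sym c~d))

    module _ {S : V → Bool} (S-comp : IsComponentSet G c d S) where

      S-c : S c ≡ true
      S-c = Equivalence.from (S-comp c) here

      S-d : S d ≡ false
      S-d = ¬-not (bridge ∘ Equivalence.to (S-comp d))

      crossing-edge : ∀ {u x} → S u ≡ true → S x ≡ false → Adjacent (E G) u x → u ≡ c × x ≡ d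
      crossing-edge {u} {x} Su Sx u~x with u ≟ c ×-dec x ≟ d | u ≟ d ×-dec x ≟ c
      ... | yes ux≡cd | _              = ux≡cd
      ... | no _      | yes (refl , _) = contradiction (trans (sym Su) S-d) λ ()
      ... | no ¬cd    | no ¬dc         = contradiction (trans (sym Sx≡true) Sx) λ ()
        where
        Sx≡true : S x ≡ true
        Sx≡true = Equivalence.from (S-comp x)
          (Equivalence.to (S-comp u) Su ▷ subst (0 ℕ.<_) (sym (deleteEdges-keeps c d ¬cd ¬dc)) u~x)

      Δ-indicator-nonneg : ∀ {u} → u ≢ c → 0ℤ ℤ.≤ Δ (indicator S) u
      Δ-indicator-nonneg {u} u≢c =
        subst (ℤ._≤ Δ (indicator S) u) (Δ-flat (λ _ → 0ℤ) u λ _ → refl)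
              (Δ-mono (λ _ → 0ℤ) (indicator S) u outward)
        where
        outward : ∀ x → Adjacent (E G) u x → 0ℤ - 0ℤ ℤ.≤ indicator S x - indicator S u
        outward x u~x with S u in Su | S x in Sx
        ... | true  | true  = ℤP.≤-refl
        ... | false | false = ℤP.≤-refl
        ... | false | true  = ℤ.+≤+ z≤n
        ... | true  | false = contradiction (proj₁ (crossing-edge Su Sx u~x)) u≢c

      module _ (f : V → ℤ) (f≤fc : ∀ x → f x ℤ.≤ f c) (fd<fc : f d ℤ.< f c) where

        Δ≤Δ-indicator : Δ f c ℤ.≤ Δ (indicator S) c
        Δ≤Δ-indicator = Δ-mono f (indicator S) c slope≤
          where
          slope≤ : ∀ x → Adjacent (E G) c x → f x - f c ℤ.≤ indicator S x - indicator S c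
          slope≤ x c~x rewrite S-c with S x in Sx
          ... | true  = ℤP.i≤j⇒i-j≤0 (f≤fc x)
          ... | false with refl ← proj₂ (crossing-edge S-c Sx c~x) = i<j⇒i-j≤-1 fd<fc

        subsetFire-effective : ∀ {D D'} → Effective G D → Effective G D' → D' ≗ D +Δ f →
                               Effective G (subsetFire G S D)
        subsetFire-effective {D} {D'} D≥0 D'≥0 D'≡ u with u ≟ c
        ... | yes refl = begin
          0ℤ                      ≤⟨ D'≥0 c ⟩
          D' c                    ≡⟨ D'≡ c ⟩
          D c + Δ f c             ≤⟨ ℤP.+-monoʳ-≤ (D c) Δ≤Δ-indicator ⟩
          D c + Δ (indicator S) c ≡⟨ subsetFire-Δ S D c ⟨
          subsetFire G S D c      ∎
          where open ℤP.≤-Reasoning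
        ... | no u≢c = begin
          0ℤ                      ≤⟨ D≥0 u ⟩
          D u                     ≡⟨ ℤP.+-identityʳ (D u) ⟨
          D u + 0ℤ                ≤⟨ ℤP.+-monoʳ-≤ (D u) (Δ-indicator-nonneg u≢c) ⟩
          D u + Δ (indicator S) u ≡⟨ subsetFire-Δ S D u ⟨
          subsetFire G S D u      ∎
          where open ℤP.≤-Reasoning

        -- The gap of f - indicator S across c–d, where indicator S c = 1 and indicator S d = 0.
        gap-drop : ∣ (f c - 1ℤ) - (f d - 0ℤ) ∣ ℕ.< ∣ f c - f d ∣
        gap-drop =
          subst (ℕ._< ∣ f c - f d ∣) (cong ∣_∣ (shift (f c) (f d))) (∣i-1∣<∣i∣ (i<j⇒0<j-i fd<fc))
          where
          shift : ∀ a b → (a - b) - 1ℤ ≡ (a - 1ℤ) - (b - 0ℤ)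
          shift = solve-∀

        gap≤ : ∀ {u x} → Adjacent (E G) u x →
               ∣ (f u - indicator S u) - (f x - indicator S x) ∣ ℕ.≤ ∣ f u - f x ∣
        gap≤ {u} {x} u~x with S u in Su | S x in Sx
        ... | true  | true  = ℕP.≤-reflexive (cong ∣_∣ ([i-k]-[j-k]≡i-j (f u) (f x) 1ℤ))
        ... | false | false = ℕP.≤-reflexive (cong ∣_∣ ([i-k]-[j-k]≡i-j (f u) (f x) 0ℤ))
        ... | true  | false with refl , refl ← crossing-edge Su Sx u~x = ℕP.<⇒≤ gap-drop
        ... | false | true  with refl , refl ← crossing-edge Sx Su (Adjacent-sym u~x) =
          subst₂ ℕ._≤_ (ℤP.∣i-j∣≡∣j-i∣ (f c - 1ℤ) (f d - 0ℤ)) (ℤP.∣i-j∣≡∣j-i∣ (f c) (f d))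
                 (ℕP.<⇒≤ gap-drop)

        variation-decreases : variation (λ x → f x - indicator S x) ℕ.< variation f
        variation-decreases =
          ∑ℕ-mono-< (λ u → ∑ℕ-mono-≤ (entry≤ u)) c (∑ℕ-mono-< (entry≤ c) d entry-cd<)
          where
          entry≤ : ∀ u x → E G u x ℕ.* ∣ (f u - indicator S u) - (f x - indicator S x) ∣
                           ℕ.≤ E G u x ℕ.* ∣ f u - f x ∣
          entry≤ u x = *-monoʳ-≤-ifPos (E G u x) gap≤
          entry-cd< : E G c d ℕ.* ∣ (f c - indicator S c) - (f d - indicator S d) ∣
                      ℕ.< E G c d ℕ.* ∣ f c - f d ∣
          entry-cd< rewrite S-c | S-d = ℕP.*-monoʳ-< (E G c d) {{ℕ.>-nonZero c~d}} gap-drop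

  descend : BananaTree G → ∀ {D'} → Effective G D' →
            ∀ D f → Acc ℕ._<_ (variation f) → Effective G D → D' ≗ D +Δ f →
            Steps (LegalAdjacencyMove G) D D'
  descend tree@(connected , acyclic) D'≥0 D f (acc smaller) D≥0 D'≡ with constant⊎peakEdge connected f
  ... | inj₁ constant = done λ u → sym (trans (D'≡ u) (+Δ-flat {D} {f} constant u))
  ... | inj₂ (c , d , c~d , f≤fc , fd<fc) =
    let (S , S-comp) = componentSet c d
        D₁≥0 = subsetFire-effective acyclic c~d S-comp f f≤fc fd<fc D≥0 D'≥0 D'≡
        decrease = variation-decreases acyclic c~d S-comp f f≤fc fd<fc
    in  more (D≥0 , D₁≥0 , c , d , S , c~d , S-comp , λ _ → refl)
             (descend tree D'≥0 (subsetFire G S D) (λ x → f x - indicator S x) (smaller decrease) D₁≥0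
                      (potential-subsetFire S {D} {_} {f} D'≡))

lemma2p4 : (G : Multigraph) → BananaTree G →
           (D D' : Divisor G) → Effective G D → Effective G D' →
           LinEquiv G D D' ⇔ Steps (LegalAdjacencyMove G) D D'
lemma2p4 G tree D D' D≥0 D'≥0 = mk⇔ toMoves (inj₁ ∘ legalMoves⇒firings G)
  where
  toMoves : LinEquiv G D D' → Steps (LegalAdjacencyMove G) D D'
  toMoves D~D' =
    let (f , D'≡D+Δf) = linEquiv⇒potential G D~D'
    in  descend G tree D'≥0 D f (<-wellFounded (variation G f)) D≥0 D'≡D+Δf
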